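{- Let $k>1$ be an integer and let $\lambda=[1^{t_1}2^{t_2}\cdots k^{t_k}]$ be a partition of $k$ with $\ell(\lambda)<k$. Then $$m_\lambda(\omega_{1,k},\omega_{2,k},\ldots,\omega_{k-1,k})=(-1)^{\ell(\lambda)}\Big(1-\frac{k}{\ell(\lambda)}\Big)\binom{\ell(\lambda)}{t_1,\ldots,t_k},$$ where $\omega_{j,k}=e^{2j\pi i/k}$ for $j=1,\ldots,k-1$.
   Context: $m_\lambda$ is the monomial symmetric function; $t_i$ is the multiplicity of the part $i$ in $\lambda$; $\ell(\lambda)=t_1+\cdots+t_k$ is the number of parts; $\binom{\ell(\lambda)}{t_1,\ldots,t_k}$ is the multinomial coefficient. -}

module Defs where

open import Level using (Level)
open import Data.Nat as ℕ using (ℕ; zero; suc; _!; NonZero; _/_)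
open import Data.Nat.Properties using (m*n≢0; _!≢0)
open import Data.Fin using (Fin; zero; suc; toℕ)
open import Data.Fin.Properties using (all?) renaming (_≟_ to _≟ᶠ_)
open import Data.Vec as Vec using (Vec; []; _∷_; lookup; count)
open import Data.List as List using (List)
open import Relation.Binary.PropositionalEquality using (_≡_)
open import Relation.Nullary using (Dec)
open import Algebra.Bundles using (CommutativeRing)

-- A partition λ of k with parts ≤ k is encoded by its multiplicity
-- vector  t : Vec ℕ k,  where  lookup t i = t_{i+1}  is the
-- multiplicity of the part  (toℕ i + 1)  in λ.

size : ∀ {k} → Vec ℕ k → ℕ
size {k} t = Vec.sum (Vec.zipWith (λ (i : Fin k) ti → suc (toℕ i) ℕ.* ti) (Vec.allFin k) t)

len : ∀ {k} → Vec ℕ k → ℕ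
len t = Vec.sum t

factProd : ∀ {k} → Vec ℕ k → ℕ
factProd [] = 1
factProd (x ∷ xs) = x ! ℕ.* factProd xs

factProd≢0 : ∀ {k} (t : Vec ℕ k) → NonZero (factProd t)
factProd≢0 [] = _
factProd≢0 (x ∷ xs) = m*n≢0 (x !) (factProd xs) {{x !≢0}} {{factProd≢0 xs}}

multinomial : ∀ {k} → Vec ℕ k → ℕ
multinomial t = (len t !) / factProd t
  where instance _ = factProd≢0 t

-- Monomial symmetric function m_λ in n variables.
-- m_λ(x_1,…,x_n) = Σ x_1^{α_1} ⋯ x_n^{α_n}, the sum over all exponent
-- vectors α ∈ ℕ^n that are rearrangements of (λ_1,…,λ_ℓ,0,…,0), i.e.
-- over all α (entries ≤ k) in which each part value i ∈ {1,…,k} occurs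
-- exactly t_i times (hence 0 occurs n - ℓ(λ) times; empty if ℓ(λ) > n).

allVecs : ∀ {a} {A : Set a} → List A → (n : ℕ) → List (Vec A n)
allVecs xs zero = List.[ [] ]
allVecs xs (suc n) = List.concatMap (λ x → List.map (x ∷_) (allVecs xs n)) xs

HasType : ∀ {k n} → Vec ℕ k → Vec (Fin (suc k)) n → Set
HasType {k} t α = ∀ (i : Fin k) → count (_≟ᶠ suc i) α ≡ lookup t i

hasType? : ∀ {k n} (t : Vec ℕ k) (α : Vec (Fin (suc k)) n) → Dec (HasType t α)
hasType? t α = all? (λ i → count (_≟ᶠ suc i) α ℕ.≟ lookup t i)

module _ {c ℓ : Level} (R : CommutativeRing c ℓ) where
  open CommutativeRing R
  open import Algebra.Bundles using (Semiring)
  open import Algebra.Definitions.RawSemiring (Semiring.rawSemiring semiring) using (_^_; _×_)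

  pow : Carrier → ℕ → Carrier
  pow = _^_

  -- n · x  (n-fold sum; n · 1 is the image of n ∈ ℕ in R)
  scal : ℕ → Carrier → Carrier
  scal = _×_

  monomial : ∀ {n k} → (Fin n → Carrier) → Vec (Fin (suc k)) n → Carrier
  monomial x α = Vec.foldr _ _*_ 1# (Vec.zipWith (λ xi a → xi ^ toℕ a) (Vec.tabulate x) α)

  monomialSym : ∀ {k} → Vec ℕ k → ∀ {n} → (Fin n → Carrier) → Carrier
  monomialSym {k} t {n} x =
    List.foldr _+_ 0# (List.map (monomial x) (List.filter (hasType? t) (allVecs (List.allFin (suc k)) n)))

-- Work with the augmented monomial function m̃_λ = t₁!⋯t_k! m_λ: it is symmetric, homogeneous of
-- degree |λ|, and obeys the deletion identity Σᵢ m̃_λ(zs ∖ zᵢ) = (n − ℓ(λ)) m̃_λ(zs) in n variables.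
-- Let ρ = (1, ω, …, ω^{k−1}). Multiplication by ω permutes ρ, so m̃_μ(ρ) = ω^{|μ|} m̃_μ(ρ) = 0 when
-- 0 < |μ| < k; expanding m̃_μ(ρ) in its variable 1 then gives m̃_μ(ω, …, ω^{k−1}) = (−1)^{ℓ(μ)} ℓ(μ)!
-- by induction on ℓ(μ). When |λ| = k, deleting any ω^a from ρ leaves a rotation of ω^a·(ω, …, ω^{k−1}),
-- whose m̃_λ-value is unchanged since ω^{ak} = 1. The deletion identity for ρ then reads
-- k R + ℓ (R + W) = k (R + W) with R = m̃_λ(ω, …, ω^{k−1}) and W = (−1)^{ℓ−1} ℓ!, so ℓ R = (k − ℓ) W,
-- and dividing by t₁!⋯t_k! (characteristic 0, no zero divisors) gives the formula.

module Submission where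

open import Defs
open import Level using (Level)
open import Data.Nat as ℕ using (ℕ; zero; suc; _<_; _≤_; _∸_; z≤n; s≤s; _!)
import Data.Nat.Properties as ℕₚ
open import Data.Nat.Divisibility using (_∣_; ∣-refl; ∣-trans; *-monoʳ-∣)
open import Data.Nat.DivMod using (m*[n/m]≡n)
open import Data.Nat.Combinatorics using (k![n∸k]!∣n!)
import Algebra.Properties.CommutativeSemigroup ℕₚ.*-commutativeSemigroup as ℕ*
import Algebra.Properties.CommutativeSemigroup ℕₚ.+-commutativeSemigroup as ℕ+
open import Data.Fin using (Fin; toℕ; zero; suc)
open import Data.Fin.Properties using (toℕ<n) renaming (_≟_ to _≟ᶠ_)
open import Data.Bool using (true; false; if_then_else_)
open import Data.Vec as Vec using (Vec; []; _∷_; lookup)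
open import Data.List as List using (List; []; _∷_; _++_)
open import Data.List.Properties using (filter-++; filter-≐; filter-none; filter-accept; filter-reject; map-concatMap; map-tabulate; map-∘)
import Data.List.Relation.Unary.All as All
open import Data.List.Relation.Binary.Pointwise as Pointwise using (Pointwise)
open import Data.List.Relation.Binary.Permutation.Propositional as ↭ using (_↭_)
open import Data.List.Relation.Binary.Permutation.Propositional.Properties using (++-comm)
open import Data.Sum using (_⊎_; inj₁; inj₂)
open import Data.Product using (_,_)
open import Data.Empty using (⊥-elim)
open import Relation.Unary using (Pred; Decidable)
open import Relation.Nullary using (¬_; Dec; yes; no; does)
open import Relation.Binary.PropositionalEquality as ≡ using (_≡_; _≢_)
open import Algebra.Bundles using (CommutativeRing)
open import Function using (_∘_; id)

-- Remove one part of size toℕ i + 1 from λ (a no-op when λ has none).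
removePart : ∀ {k} → Fin k → Vec ℕ k → Vec ℕ k
removePart zero    (m ∷ t) = ℕ.pred m ∷ t
removePart (suc i) (m ∷ t) = m ∷ removePart i t

removePart-comm : ∀ {k} (i j : Fin k) (t : Vec ℕ k) →
                  removePart i (removePart j t) ≡ removePart j (removePart i t)
removePart-comm zero    zero    (m ∷ t) = ≡.refl
removePart-comm zero    (suc j) (m ∷ t) = ≡.refl
removePart-comm (suc i) zero    (m ∷ t) = ≡.refl
removePart-comm (suc i) (suc j) (m ∷ t) = ≡.cong (m ∷_) (removePart-comm i j t)

lookup-removePart-same : ∀ {k} (i : Fin k) (t : Vec ℕ k) →
                         lookup (removePart i t) i ≡ ℕ.pred (lookup t i)
lookup-removePart-same zero    (m ∷ t) = ≡.refl
lookup-removePart-same (suc i) (m ∷ t) = lookup-removePart-same i t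

lookup-removePart-other : ∀ {k} {i j : Fin k} (t : Vec ℕ k) → i ≢ j →
                          lookup (removePart i t) j ≡ lookup t j
lookup-removePart-other {i = zero}  {zero}  t       i≢j = ⊥-elim (i≢j ≡.refl)
lookup-removePart-other {i = zero}  {suc j} (m ∷ t) i≢j = ≡.refl
lookup-removePart-other {i = suc i} {zero}  (m ∷ t) i≢j = ≡.refl
lookup-removePart-other {i = suc i} {suc j} (m ∷ t) i≢j = lookup-removePart-other t (i≢j ∘ ≡.cong suc)

lookup*lookup-removePart-comm : ∀ {k} (i j : Fin k) (t : Vec ℕ k) →
  lookup t i ℕ.* lookup (removePart i t) j ≡ lookup t j ℕ.* lookup (removePart j t) i
lookup*lookup-removePart-comm zero    zero    (m ∷ t) = ≡.refl
lookup*lookup-removePart-comm zero    (suc j) (m ∷ t) = ℕₚ.*-comm m (lookup t j)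
lookup*lookup-removePart-comm (suc i) zero    (m ∷ t) = ℕₚ.*-comm (lookup t i) m
lookup*lookup-removePart-comm (suc i) (suc j) (m ∷ t) = lookup*lookup-removePart-comm i j t

len-removePart : ∀ {k} (i : Fin k) (t : Vec ℕ k) → 0 < lookup t i →
                 len t ≡ suc (len (removePart i t))
len-removePart zero    (suc m ∷ t) _   = ≡.refl
len-removePart (suc i) (m ∷ t)     m>0 =
  ≡.trans (≡.cong (m ℕ.+_) (len-removePart i t m>0)) (ℕₚ.+-suc m _)

factProd-removePart : ∀ {k} (i : Fin k) (t : Vec ℕ k) → 0 < lookup t i →
                      factProd t ≡ lookup t i ℕ.* factProd (removePart i t)
factProd-removePart zero    (suc m ∷ t) _   = ℕₚ.*-assoc (suc m) (m !) (factProd t)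
factProd-removePart (suc i) (m ∷ t)     m>0 = begin
  m ! ℕ.* factProd t                                   ≡⟨ ≡.cong (m ! ℕ.*_) (factProd-removePart i t m>0) ⟩
  m ! ℕ.* (lookup t i ℕ.* factProd (removePart i t))  ≡⟨ ℕ*.x∙yz≈y∙xz (m !) (lookup t i) _ ⟩
  lookup t i ℕ.* (m ! ℕ.* factProd (removePart i t))  ∎
  where open ≡.≡-Reasoning

len≡0⇒lookup≡0 : ∀ {k} (t : Vec ℕ k) → len t ≡ 0 → ∀ i → 0 ≡ lookup t i
len≡0⇒lookup≡0 (zero ∷ t) len≡0 zero    = ≡.refl
len≡0⇒lookup≡0 (zero ∷ t) len≡0 (suc i) = len≡0⇒lookup≡0 t len≡0 i

factProd-allZero : ∀ {k} (t : Vec ℕ k) → (∀ i → 0 ≡ lookup t i) → factProd t ≡ 1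
factProd-allZero []      _     = ≡.refl
factProd-allZero (m ∷ t) zeros with zeros zero
... | ≡.refl = ≡.trans (ℕₚ.+-identityʳ (factProd t)) (factProd-allZero t (zeros ∘ suc))

factProd∣len! : ∀ {k} (t : Vec ℕ k) → factProd t ∣ len t !
factProd∣len! []      = ∣-refl
factProd∣len! (m ∷ t) = ∣-trans (*-monoʳ-∣ (m !) (factProd∣len! t))
  (≡.subst (λ n → m ! ℕ.* n ! ∣ (m ℕ.+ len t) !) (ℕₚ.m+n∸m≡n m (len t)) (k![n∸k]!∣n! (ℕₚ.m≤m+n m (len t))))

factProd*multinomial : ∀ {k} (t : Vec ℕ k) → factProd t ℕ.* multinomial t ≡ len t !
factProd*multinomial t = m*[n/m]≡n {{factProd≢0 t}} (factProd∣len! t)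

weightedSum : ∀ {k} → (Fin k → ℕ) → Vec ℕ k → ℕ
weightedSum w []      = 0
weightedSum w (m ∷ t) = w zero ℕ.* m ℕ.+ weightedSum (w ∘ suc) t

size≡weightedSum : ∀ {k} (t : Vec ℕ k) → size t ≡ weightedSum (suc ∘ toℕ) t
size≡weightedSum {k} = go (λ i → i)
  where
  go : ∀ {n} (h : Fin n → Fin k) (t : Vec ℕ n) →
       Vec.sum (Vec.zipWith (λ (i : Fin k) ti → suc (toℕ i) ℕ.* ti) (Vec.tabulate h) t)
         ≡ weightedSum (suc ∘ toℕ ∘ h) t
  go h []      = ≡.refl
  go h (m ∷ t) = ≡.cong (suc (toℕ (h zero)) ℕ.* m ℕ.+_) (go (h ∘ suc) t)

weightedSum-removePart : ∀ {k} (w : Fin k → ℕ) (i : Fin k) (t : Vec ℕ k) → 0 < lookup t i →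
                         weightedSum w t ≡ w i ℕ.+ weightedSum w (removePart i t)
weightedSum-removePart w zero (suc m ∷ t) _ = begin
  w zero ℕ.* suc m ℕ.+ rest            ≡⟨ ≡.cong (ℕ._+ rest) (ℕₚ.*-suc (w zero) m) ⟩
  w zero ℕ.+ w zero ℕ.* m ℕ.+ rest     ≡⟨ ℕₚ.+-assoc (w zero) _ rest ⟩
  w zero ℕ.+ (w zero ℕ.* m ℕ.+ rest)   ∎
  where
  open ≡.≡-Reasoning
  rest = weightedSum (w ∘ suc) t
weightedSum-removePart w (suc i) (m ∷ t) m>0 = begin
  w zero ℕ.* m ℕ.+ weightedSum (w ∘ suc) t                                ≡⟨ ≡.cong (w zero ℕ.* m ℕ.+_) (weightedSum-removePart (w ∘ suc) i t m>0) ⟩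
  w zero ℕ.* m ℕ.+ (w (suc i) ℕ.+ weightedSum (w ∘ suc) (removePart i t))  ≡⟨ ℕ+.x∙yz≈y∙xz (w zero ℕ.* m) (w (suc i)) _ ⟩
  w (suc i) ℕ.+ (w zero ℕ.* m ℕ.+ weightedSum (w ∘ suc) (removePart i t))  ∎
  where open ≡.≡-Reasoning

len≤weightedSum : ∀ {k} (w : Fin k → ℕ) (t : Vec ℕ k) → len t ≤ weightedSum (suc ∘ w) t
len≤weightedSum w []      = z≤n
len≤weightedSum w (m ∷ t) = ℕₚ.+-mono-≤ (ℕₚ.m≤m+n m (w zero ℕ.* m)) (len≤weightedSum (w ∘ suc) t)

len≡0⇒weightedSum≡0 : ∀ {k} (w : Fin k → ℕ) (t : Vec ℕ k) → len t ≡ 0 → weightedSum w t ≡ 0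
len≡0⇒weightedSum≡0 w []         _     = ≡.refl
len≡0⇒weightedSum≡0 w (zero ∷ t) len≡0 =
  ≡.trans (≡.cong (ℕ._+ weightedSum (w ∘ suc) t) (ℕₚ.*-zeroʳ (w zero))) (len≡0⇒weightedSum≡0 (w ∘ suc) t len≡0)

size-removePart : ∀ {k} (i : Fin k) (t : Vec ℕ k) → 0 < lookup t i →
                  size t ≡ suc (toℕ i) ℕ.+ size (removePart i t)
size-removePart i t t[i]>0 rewrite size≡weightedSum t | size≡weightedSum (removePart i t) =
  weightedSum-removePart (suc ∘ toℕ) i t t[i]>0

size-removePart< : ∀ {k} (i : Fin k) (t : Vec ℕ k) → 0 < lookup t i → size (removePart i t) < size t
size-removePart< i t t[i]>0 =
  ≡.subst (size (removePart i t) <_) (≡.sym (size-removePart i t t[i]>0)) (ℕₚ.m<n+m _ (s≤s z≤n))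

len≤size : ∀ {k} (t : Vec ℕ k) → len t ≤ size t
len≤size t rewrite size≡weightedSum t = len≤weightedSum toℕ t

0<size⇒0<len : ∀ {k} (t : Vec ℕ k) → 0 < size t → 0 < len t
0<size⇒0<len t size>0 with len t in eq
... | suc _ = s≤s z≤n
... | zero  = ⊥-elim (ℕₚ.<-irrefl (≡.sym size≡0) size>0)
  where
  size≡0 : size t ≡ 0
  size≡0 = ≡.trans (size≡weightedSum t) (len≡0⇒weightedSum≡0 (suc ∘ toℕ) t eq)

module _ {k n} (t : Vec ℕ k) (j : Fin k) (α : Vec (Fin (suc k)) n) where

  hasType-∷⇒positive : HasType t (suc j ∷ α) → 0 < lookup t j
  hasType-∷⇒positive h = positive (j ≟ᶠ j) (h j)
    where
    positive : (d : Dec (j ≡ j)) →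
               (if does d then suc else id) (Vec.count (_≟ᶠ suc j) α) ≡ lookup t j → 0 < lookup t j
    positive (yes _)   eq = ≡.subst (0 <_) eq (s≤s z≤n)
    positive (no j≢j) _  = ⊥-elim (j≢j ≡.refl)

  hasType-∷⇒hasType-removePart : HasType t (suc j ∷ α) → HasType (removePart j t) α
  hasType-∷⇒hasType-removePart h i = step (j ≟ᶠ i) (h i)
    where
    step : (d : Dec (j ≡ i)) →
           (if does d then suc else id) (Vec.count (_≟ᶠ suc i) α) ≡ lookup t i →
           Vec.count (_≟ᶠ suc i) α ≡ lookup (removePart j t) i
    step (yes ≡.refl) eq = ≡.trans (≡.cong ℕ.pred eq) (≡.sym (lookup-removePart-same j t))
    step (no j≢i)     eq = ≡.trans eq (≡.sym (lookup-removePart-other t j≢i))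

  hasType-removePart⇒hasType-∷ : 0 < lookup t j → HasType (removePart j t) α → HasType t (suc j ∷ α)
  hasType-removePart⇒hasType-∷ t[j]>0 h i = step (j ≟ᶠ i) (h i)
    where
    step : (d : Dec (j ≡ i)) →
           Vec.count (_≟ᶠ suc i) α ≡ lookup (removePart j t) i →
           (if does d then suc else id) (Vec.count (_≟ᶠ suc i) α) ≡ lookup t i
    step (yes ≡.refl) eq = ≡.trans (≡.cong suc (≡.trans eq (lookup-removePart-same j t)))
                                   (ℕₚ.suc-pred (lookup t j) {{ℕ.>-nonZero t[j]>0}})
    step (no j≢i)     eq = ≡.trans eq (lookup-removePart-other t j≢i)

module _ {a b p} {A : Set a} {B : Set b} {P : Pred B p} (P? : Decidable P) where

  filter-map : (f : A → B) (xs : List A) →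
               List.filter P? (List.map f xs) ≡ List.map f (List.filter (P? ∘ f) xs)
  filter-map f []       = ≡.refl
  filter-map f (x ∷ xs) with does (P? (f x))
  ... | true  = ≡.cong (f x ∷_) (filter-map f xs)
  ... | false = filter-map f xs

  filter-concatMap : (f : A → List B) (xs : List A) →
                     List.filter P? (List.concatMap f xs) ≡ List.concatMap (List.filter P? ∘ f) xs
  filter-concatMap f []       = ≡.refl
  filter-concatMap f (x ∷ xs) =
    ≡.trans (filter-++ P? (f x) (List.concatMap f xs)) (≡.cong (List.filter P? (f x) ++_) (filter-concatMap f xs))

module _ {k n} (t : Vec ℕ k) (j : Fin k) (αs : List (Vec (Fin (suc k)) n)) where

  filter-hasType-∷-positive : 0 < lookup t j →
    List.filter (hasType? t ∘ (suc j ∷_)) αs ≡ List.filter (hasType? (removePart j t)) αs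
  filter-hasType-∷-positive t[j]>0 = filter-≐ (hasType? t ∘ (suc j ∷_)) (hasType? (removePart j t))
    ((λ {α} → hasType-∷⇒hasType-removePart t j α) , (λ {α} → hasType-removePart⇒hasType-∷ t j α t[j]>0)) αs

  filter-hasType-∷-zero : lookup t j ≡ 0 → List.filter (hasType? t ∘ (suc j ∷_)) αs ≡ []
  filter-hasType-∷-zero t[j]≡0 = filter-none (hasType? t ∘ (suc j ∷_))
    (All.universal (λ α h → ℕₚ.<-irrefl (≡.sym t[j]≡0) (hasType-∷⇒positive t j α h)) αs)

module _ {c ℓ} (R : CommutativeRing c ℓ) where
  open CommutativeRing R hiding (zero)
  open import Algebra.Properties.Semiring.Mult semiring
  open import Algebra.Properties.CommutativeMonoid.Mult +-commutativeMonoid using (×-distrib-+)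
  open import Algebra.Properties.Semiring.Exp semiring
  open import Algebra.Properties.CommutativeSemiring.Exp commutativeSemiring using (^-distrib-*)
  open import Algebra.Properties.Semiring.Sum semiring
    using (sum; sum-syntax; ∑-distrib-+; ∑-comm; *-distribˡ-sum; sum-cong-≋; sum-replicate; sum-replicate-zero)
  open import Algebra.Properties.CommutativeSemigroup +-commutativeSemigroup
    using () renaming (interchange to +-interchange; x∙yz≈y∙xz to x+[y+z]≈y+[x+z])
  open import Algebra.Properties.CommutativeSemigroup *-commutativeSemigroup
    using () renaming (x∙yz≈y∙xz to x*[y*z]≈y*[x*z]; interchange to *-interchange)
  open import Algebra.Properties.Ring ring
    using (-1*x≈-x; -‿involutive; +-cancelˡ; +-cancelʳ; +-inverseˡ-unique; x∙y⁻¹≈ε⇒x≈y; [y-z]x≈yx-zx; x[y-z]≈xy-xz)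
  open import Relation.Binary.Reasoning.Setoid setoid

  ×-zeroʳ : ∀ n → n × 0# ≈ 0#
  ×-zeroʳ n = trans (sym (sum-replicate n)) (sum-replicate-zero n)

  ×-distrib-sum : ∀ {k} n (f : Fin k → Carrier) → n × sum f ≈ ∑[ i < k ] (n × f i)
  ×-distrib-sum {zero}  n f = ×-zeroʳ n
  ×-distrib-sum {suc k} n f = trans (×-distrib-+ _ _ n) (+-congˡ (×-distrib-sum n (f ∘ suc)))

  ×-comm : ∀ m n x → m × (n × x) ≈ n × (m × x)
  ×-comm m n x = trans (×-assocˡ x m n) (trans (×-congˡ (ℕₚ.*-comm m n)) (sym (×-assocˡ x n m)))

  ×-cong-positive : ∀ n {x y} → (0 < n → x ≈ y) → n × x ≈ n × y
  ×-cong-positive zero    _   = refl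
  ×-cong-positive (suc n) x≈y = ×-congʳ (suc n) (x≈y (s≤s z≤n))

  1^n≈1 : ∀ n → 1# ^ n ≈ 1#
  1^n≈1 zero    = refl
  1^n≈1 (suc n) = trans (*-identityˡ _) (1^n≈1 n)

  ∑-lookup×-const : ∀ {k} (t : Vec ℕ k) (f : Fin k → Carrier) {x} → (∀ i → 0 < lookup t i → f i ≈ x) →
                    ∑[ i < k ] (lookup t i × f i) ≈ len t × x
  ∑-lookup×-const []      f f≈x = refl
  ∑-lookup×-const (m ∷ t) f {x} f≈x = begin
    m × f zero + ∑[ i < _ ] (lookup t i × f (suc i))
      ≈⟨ +-cong (×-cong-positive m (f≈x zero)) (∑-lookup×-const t (f ∘ suc) (f≈x ∘ suc)) ⟩
    m × x + len t × x                                  ≈⟨ ×-homo-+ x m (len t) ⟨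
    (m ℕ.+ len t) × x                                  ∎

  emptyIndicator : ∀ {k} → Vec ℕ k → Carrier
  emptyIndicator []          = 1#
  emptyIndicator (zero  ∷ t) = emptyIndicator t
  emptyIndicator (suc _ ∷ t) = 0#

  emptyIndicator-allZero : ∀ {k} (t : Vec ℕ k) → (∀ i → 0 ≡ lookup t i) → emptyIndicator t ≈ 1#
  emptyIndicator-allZero []      _     = refl
  emptyIndicator-allZero (m ∷ t) zeros with zeros zero
  ... | ≡.refl = emptyIndicator-allZero t (zeros ∘ suc)

  emptyIndicator-notAllZero : ∀ {k} (t : Vec ℕ k) → ¬ (∀ i → 0 ≡ lookup t i) → emptyIndicator t ≈ 0#
  emptyIndicator-notAllZero []          notZeros = ⊥-elim (notZeros λ ())
  emptyIndicator-notAllZero (zero ∷ t)  notZeros =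
    emptyIndicator-notAllZero t λ zeros → notZeros λ { zero → ≡.refl ; (suc i) → zeros i }
  emptyIndicator-notAllZero (suc m ∷ t) _        = refl

  emptyIndicator-absorbs : ∀ {k} (w : Fin k → ℕ) (t : Vec ℕ k) c →
                           emptyIndicator t ≈ c ^ weightedSum w t * emptyIndicator t
  emptyIndicator-absorbs w []          c = sym (*-identityʳ 1#)
  emptyIndicator-absorbs w (zero ∷ t)  c = trans (emptyIndicator-absorbs (w ∘ suc) t c)
    (*-congʳ (^-congʳ c (≡.cong (ℕ._+ weightedSum (w ∘ suc) t) (≡.sym (ℕₚ.*-zeroʳ (w zero))))))
  emptyIndicator-absorbs w (suc _ ∷ t) c = sym (zeroʳ _)

  len×emptyIndicator≈0 : ∀ {k} (t : Vec ℕ k) → len t × emptyIndicator t ≈ 0#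
  len×emptyIndicator≈0 []          = refl
  len×emptyIndicator≈0 (zero ∷ t)  = len×emptyIndicator≈0 t
  len×emptyIndicator≈0 (suc m ∷ t) = ×-zeroʳ (suc m ℕ.+ len t)

  -- m̃_λ(z, zs) = m̃_λ(zs) + Σᵢ tᵢ z^i m̃_{λ∖i}(zs): the augmented monomial function t₁! ⋯ t_k! m_λ,
  -- expanded in its first variable.
  augmented : ∀ {k} → Vec ℕ k → List Carrier → Carrier
  augmented     t []       = emptyIndicator t
  augmented {k} t (z ∷ zs) =
    augmented t zs + ∑[ i < k ] (lookup t i × (z ^ suc (toℕ i) * augmented (removePart i t) zs))

  augmented-cong : ∀ {k} (t : Vec ℕ k) {xs ys} → Pointwise _≈_ xs ys → augmented t xs ≈ augmented t ys
  augmented-cong t Pointwise.[]            = refl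
  augmented-cong t (x≈y Pointwise.∷ xs≈ys) = +-cong (augmented-cong t xs≈ys)
    (sum-cong-≋ λ i → ×-congʳ (lookup t i) (*-cong (^-congˡ (suc (toℕ i)) x≈y) (augmented-cong (removePart i t) xs≈ys)))

  -- Expanding in two variables, the cross terms are symmetric because removing two parts commutes.
  module _ {k} (t : Vec ℕ k) (zs : List Carrier) where
    private
      firstTerm : Carrier → Fin k → Carrier
      firstTerm z i = lookup t i × (z ^ suc (toℕ i) * augmented (removePart i t) zs)

      firstTerms : Carrier → Carrier
      firstTerms z = sum (firstTerm z)

      secondTerm : Carrier → Carrier → Fin k → Fin k → Carrier
      secondTerm a b i j = (lookup t i ℕ.* lookup (removePart i t) j) ×
                           (a ^ suc (toℕ i) * (b ^ suc (toℕ j) * augmented (removePart j (removePart i t)) zs))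

      secondTerms : Carrier → Carrier → Carrier
      secondTerms a b = ∑[ i < k ] ∑[ j < k ] secondTerm a b i j

      augmented-∷-∷ : ∀ a b → augmented t (a ∷ b ∷ zs) ≈ (augmented t zs + firstTerms b) + (firstTerms a + secondTerms a b)
      augmented-∷-∷ a b = +-congˡ (begin
        ∑[ i < k ] (lookup t i × (a ^ suc (toℕ i) * (augmented (removePart i t) zs + inner i)))
          ≈⟨ sum-cong-≋ (λ i → trans (×-congʳ (lookup t i) (distribˡ _ _ _)) (×-distrib-+ _ _ (lookup t i))) ⟩
        ∑[ i < k ] (lookup t i × (a ^ suc (toℕ i) * augmented (removePart i t) zs) + lookup t i × (a ^ suc (toℕ i) * inner i))
          ≈⟨ ∑-distrib-+ (firstTerm a) (λ i → lookup t i × (a ^ suc (toℕ i) * inner i)) ⟩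
        firstTerms a + ∑[ i < k ] (lookup t i × (a ^ suc (toℕ i) * inner i))
          ≈⟨ +-congˡ (sum-cong-≋ expand-inner) ⟩
        firstTerms a + secondTerms a b ∎)
        where
        innerTerm : Fin k → Fin k → Carrier
        innerTerm i j = lookup (removePart i t) j × (b ^ suc (toℕ j) * augmented (removePart j (removePart i t)) zs)
        inner : Fin k → Carrier
        inner i = sum (innerTerm i)
        expand-inner : ∀ i → lookup t i × (a ^ suc (toℕ i) * inner i) ≈ ∑[ j < k ] secondTerm a b i j
        expand-inner i = begin
          m × (aⁱ * inner i)                    ≈⟨ ×-congʳ m (*-distribˡ-sum aⁱ (innerTerm i)) ⟩
          m × ∑[ j < k ] (aⁱ * innerTerm i j)   ≈⟨ ×-distrib-sum m (λ j → aⁱ * innerTerm i j) ⟩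
          ∑[ j < k ] (m × (aⁱ * innerTerm i j)) ≈⟨ sum-cong-≋ {k} (λ j →
                                                     trans (×-congʳ m (×-comm-* (lookup (removePart i t) j) aⁱ _)) (×-assocˡ _ m _)) ⟩
          ∑[ j < k ] secondTerm a b i j         ∎
          where
          m = lookup t i
          aⁱ = a ^ suc (toℕ i)

      secondTerms-comm : ∀ a b → secondTerms a b ≈ secondTerms b a
      secondTerms-comm a b = trans (∑-comm (secondTerm a b)) (sum-cong-≋ λ i → sum-cong-≋ λ j →
        ×-cong (lookup*lookup-removePart-comm j i t)
               (trans (x*[y*z]≈y*[x*z] _ _ _)
                      (*-congˡ (*-congˡ (reflexive (≡.cong (λ s → augmented s zs) (removePart-comm i j t)))))))

    augmented-swap : ∀ a b → augmented t (a ∷ b ∷ zs) ≈ augmented t (b ∷ a ∷ zs)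
    augmented-swap a b = begin
      augmented t (a ∷ b ∷ zs)                                                     ≈⟨ augmented-∷-∷ a b ⟩
      (augmented t zs + firstTerms b) + (firstTerms a + secondTerms a b)          ≈⟨ +-interchange _ _ _ _ ⟩
      (augmented t zs + firstTerms a) + (firstTerms b + secondTerms a b)          ≈⟨ +-congˡ (+-congˡ (secondTerms-comm a b)) ⟩
      (augmented t zs + firstTerms a) + (firstTerms b + secondTerms b a)          ≈⟨ augmented-∷-∷ b a ⟨
      augmented t (b ∷ a ∷ zs)                                                     ∎

  augmented-∷-cong : ∀ {k} z {xs ys} → (∀ (s : Vec ℕ k) → augmented s xs ≈ augmented s ys) →
                     ∀ (t : Vec ℕ k) → augmented t (z ∷ xs) ≈ augmented t (z ∷ ys)
  augmented-∷-cong z xs≈ys t =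
    +-cong (xs≈ys t) (sum-cong-≋ λ i → ×-congʳ (lookup t i) (*-congˡ (xs≈ys (removePart i t))))

  augmented-perm : ∀ {k} {xs ys} → xs ↭ ys → ∀ (t : Vec ℕ k) → augmented t xs ≈ augmented t ys
  augmented-perm ↭.refl                   t = refl
  augmented-perm (↭.prep {xs} {ys} z p)   t = augmented-∷-cong z {xs} {ys} (augmented-perm p) t
  augmented-perm (↭.swap {xs} {ys} a b p) t =
    trans (augmented-∷-cong a {b ∷ xs} {b ∷ ys} (augmented-∷-cong b {xs} {ys} (augmented-perm p)) t)
          (augmented-swap t ys a b)
  augmented-perm (↭.trans p q)            t = trans (augmented-perm p t) (augmented-perm q t)

  augmented-homogeneous : ∀ {k} c (t : Vec ℕ k) zs →
                          augmented t (List.map (c *_) zs) ≈ c ^ size t * augmented t zs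
  augmented-homogeneous c t [] rewrite size≡weightedSum t = emptyIndicator-absorbs (suc ∘ toℕ) t c
  augmented-homogeneous {k} c t (z ∷ zs) = begin
    augmented t (List.map (c *_) zs) + ∑[ i < k ] (lookup t i × ((c * z) ^ e i * augmented (removePart i t) (List.map (c *_) zs)))
      ≈⟨ +-cong (augmented-homogeneous c t zs)
                (sum-cong-≋ {k} λ i → ×-congʳ (lookup t i) (*-congˡ (augmented-homogeneous c (removePart i t) zs))) ⟩
    cˢ * augmented t zs + ∑[ i < k ] (lookup t i × ((c * z) ^ e i * (c ^ size (removePart i t) * augmented (removePart i t) zs)))
      ≈⟨ +-congˡ (sum-cong-≋ {k} term) ⟩
    cˢ * augmented t zs + ∑[ i < k ] (cˢ * (lookup t i × (z ^ e i * augmented (removePart i t) zs)))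
      ≈⟨ +-congˡ (*-distribˡ-sum cˢ (λ i → lookup t i × (z ^ e i * augmented (removePart i t) zs))) ⟨
    cˢ * augmented t zs + cˢ * ∑[ i < k ] (lookup t i × (z ^ e i * augmented (removePart i t) zs))
      ≈⟨ distribˡ cˢ _ _ ⟨
    cˢ * augmented t (z ∷ zs) ∎
    where
    cˢ = c ^ size t
    e : Fin k → ℕ
    e i = suc (toℕ i)
    term : ∀ i → lookup t i × ((c * z) ^ e i * (c ^ size (removePart i t) * augmented (removePart i t) zs))
                 ≈ cˢ * (lookup t i × (z ^ e i * augmented (removePart i t) zs))
    term i = trans (×-cong-positive (lookup t i) λ t[i]>0 → begin
      (c * z) ^ e i * (c ^ size (removePart i t) * augmented (removePart i t) zs)
        ≈⟨ *-congʳ (^-distrib-* c z (e i)) ⟩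
      (c ^ e i * z ^ e i) * (c ^ size (removePart i t) * augmented (removePart i t) zs)
        ≈⟨ *-interchange _ _ _ _ ⟩
      (c ^ e i * c ^ size (removePart i t)) * (z ^ e i * augmented (removePart i t) zs)
        ≈⟨ *-congʳ (trans (^-congʳ c (size-removePart i t t[i]>0)) (^-homo-* c (e i) _)) ⟨
      cˢ * (z ^ e i * augmented (removePart i t) zs) ∎)
      (sym (×-comm-* (lookup t i) cˢ _))

  removalSum : ∀ {k} → Vec ℕ k → List Carrier → Carrier
  removalSum t zs = ∑[ i < List.length zs ] augmented t (List.removeAt zs i)

  removalSum-∷ : ∀ {k} (t : Vec ℕ k) z zs →
                 removalSum t (z ∷ zs) ≈
                 augmented t zs + (removalSum t zs + ∑[ j < k ] (lookup t j × (z ^ suc (toℕ j) * removalSum (removePart j t) zs)))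
  removalSum-∷ {k} t z zs = +-congˡ (begin
    ∑[ i < n ] (augmented t (removeAt i) + ∑[ j < k ] term i j)   ≈⟨ ∑-distrib-+ (augmented t ∘ removeAt) (λ i → sum (term i)) ⟩
    removalSum t zs + ∑[ i < n ] ∑[ j < k ] term i j              ≈⟨ +-congˡ (∑-comm term) ⟩
    removalSum t zs + ∑[ j < k ] ∑[ i < n ] term i j              ≈⟨ +-congˡ (sum-cong-≋ {k} factor) ⟩
    removalSum t zs + ∑[ j < k ] (lookup t j × (z ^ suc (toℕ j) * removalSum (removePart j t) zs)) ∎)
    where
    n = List.length zs
    removeAt = List.removeAt zs
    term : Fin n → Fin k → Carrier
    term i j = lookup t j × (z ^ suc (toℕ j) * augmented (removePart j t) (removeAt i))
    factor : ∀ j → ∑[ i < n ] term i j ≈ lookup t j × (z ^ suc (toℕ j) * removalSum (removePart j t) zs)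
    factor j = sym (trans (×-congʳ (lookup t j) (*-distribˡ-sum _ (augmented (removePart j t) ∘ removeAt)))
                          (×-distrib-sum (lookup t j) (λ i → z ^ suc (toℕ j) * augmented (removePart j t) (removeAt i))))

  -- Each monomial of m̃_λ(zs) involves exactly ℓ(λ) of the variables, so it survives the deletion
  -- of each of the other length zs ∸ ℓ(λ) variables.
  removalSum+len×augmented : ∀ {k} (t : Vec ℕ k) zs →
                             removalSum t zs + len t × augmented t zs ≈ List.length zs × augmented t zs
  removalSum+len×augmented t [] = trans (+-identityˡ _) (len×emptyIndicator≈0 t)
  removalSum+len×augmented {k} t (z ∷ zs) = begin
    removalSum t (z ∷ zs) + l × (N + sum first)
      ≈⟨ +-cong (removalSum-∷ t z zs) (×-distrib-+ N (sum first) l) ⟩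
    (N + (removalSum t zs + sum second)) + (l × N + l × sum first)
      ≈⟨ regroup N (removalSum t zs) (sum second) (l × N) (l × sum first) ⟩
    (N + (removalSum t zs + l × N)) + (sum second + l × sum first)
      ≈⟨ +-cong (+-congˡ (removalSum+len×augmented t zs)) (+-congˡ (×-distrib-sum l first)) ⟩
    suc n × N + (sum second + ∑[ j < k ] (l × first j))
      ≈⟨ +-congˡ (∑-distrib-+ second (λ j → l × first j)) ⟨
    suc n × N + ∑[ j < k ] (second j + l × first j)
      ≈⟨ +-congˡ (sum-cong-≋ {k} per-part) ⟩
    suc n × N + ∑[ j < k ] (suc n × first j)
      ≈⟨ +-congˡ (×-distrib-sum (suc n) first) ⟨
    suc n × N + suc n × sum first
      ≈⟨ ×-distrib-+ N (sum first) (suc n) ⟨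
    suc n × augmented t (z ∷ zs) ∎
    where
    n = List.length zs
    l = len t
    N = augmented t zs
    zʲ : Fin k → Carrier
    zʲ j = z ^ suc (toℕ j)
    first second : Fin k → Carrier
    first  j = lookup t j × (zʲ j * augmented (removePart j t) zs)
    second j = lookup t j × (zʲ j * removalSum (removePart j t) zs)
    regroup : ∀ a b c d e → (a + (b + c)) + (d + e) ≈ (a + (b + d)) + (c + e)
    regroup a b c d e = trans (+-assoc a _ _) (trans (+-congˡ (+-interchange b c d e)) (sym (+-assoc a _ _)))
    per-part : ∀ j → second j + l × first j ≈ suc n × first j
    per-part j = begin
      lookup t j × (zʲ j * D) + l × (lookup t j × Y)  ≈⟨ +-congˡ (×-comm l (lookup t j) Y) ⟩
      lookup t j × (zʲ j * D) + lookup t j × (l × Y)  ≈⟨ ×-distrib-+ _ _ (lookup t j) ⟨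
      lookup t j × (zʲ j * D + l × Y)                 ≈⟨ ×-cong-positive (lookup t j) shifted ⟩
      lookup t j × (suc n × Y)                        ≈⟨ ×-comm (lookup t j) (suc n) Y ⟩
      suc n × (lookup t j × Y)                        ∎
      where
      s = removePart j t
      D = removalSum s zs
      Y = zʲ j * augmented s zs
      shifted : 0 < lookup t j → zʲ j * D + l × Y ≈ suc n × Y
      shifted t[j]>0 = begin
        zʲ j * D + l × Y                                  ≈⟨ +-congˡ (×-congˡ (len-removePart j t t[j]>0)) ⟩
        zʲ j * D + (Y + len s × Y)                        ≈⟨ x+[y+z]≈y+[x+z] _ Y _ ⟩
        Y + (zʲ j * D + len s × Y)                        ≈⟨ +-congˡ (+-congˡ (×-comm-* (len s) (zʲ j) _)) ⟨
        Y + (zʲ j * D + zʲ j * (len s × augmented s zs))  ≈⟨ +-congˡ (distribˡ (zʲ j) D _) ⟨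
        Y + zʲ j * (D + len s × augmented s zs)           ≈⟨ +-congˡ (*-congˡ (removalSum+len×augmented s zs)) ⟩
        Y + zʲ j * (n × augmented s zs)                   ≈⟨ +-congˡ (×-comm-* n (zʲ j) _) ⟩
        suc n × Y                                         ∎

  sumₗ : List Carrier → Carrier
  sumₗ = List.foldr _+_ 0#

  sumₗ-++ : ∀ xs ys → sumₗ (xs ++ ys) ≈ sumₗ xs + sumₗ ys
  sumₗ-++ []       ys = sym (+-identityˡ _)
  sumₗ-++ (x ∷ xs) ys = trans (+-congˡ (sumₗ-++ xs ys)) (sym (+-assoc x _ _))

  sumₗ-concatMap : ∀ {a} {A : Set a} (f : A → List Carrier) xs →
                   sumₗ (List.concatMap f xs) ≈ sumₗ (List.map (sumₗ ∘ f) xs)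
  sumₗ-concatMap f []       = refl
  sumₗ-concatMap f (x ∷ xs) = trans (sumₗ-++ (f x) (List.concatMap f xs)) (+-congˡ (sumₗ-concatMap f xs))

  sumₗ-tabulate : ∀ {n} (f : Fin n → Carrier) → sumₗ (List.tabulate f) ≡ sum f
  sumₗ-tabulate {zero}  f = ≡.refl
  sumₗ-tabulate {suc n} f = ≡.cong (f zero +_) (sumₗ-tabulate (f ∘ suc))

  sumₗ-allFin : ∀ n (f : Fin n → Carrier) → sumₗ (List.map f (List.allFin n)) ≡ sum f
  sumₗ-allFin n f = ≡.trans (≡.cong sumₗ (map-tabulate id f)) (sumₗ-tabulate f)

  *-distribˡ-sumₗ : ∀ {a} {A : Set a} x (f : A → Carrier) ys →
                    x * sumₗ (List.map f ys) ≈ sumₗ (List.map (λ y → x * f y) ys)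
  *-distribˡ-sumₗ x f []       = zeroʳ x
  *-distribˡ-sumₗ x f (y ∷ ys) = trans (distribˡ x _ _) (+-congˡ (*-distribˡ-sumₗ x f ys))

  module _ {k n} (t : Vec ℕ k) (x : Fin (suc n) → Carrier) where
    private
      αs : List (Vec (Fin (suc k)) n)
      αs = allVecs (List.allFin (suc k)) n

    -- The monomials of m_λ(x) with first exponent a, with x₀^a divided out.
    slice : Fin (suc k) → Carrier
    slice a = sumₗ (List.map (monomial R (x ∘ suc)) (List.filter (hasType? t ∘ (a ∷_)) αs))

    private
      sum-monomial-∷ : ∀ a → sumₗ (List.map (monomial R x) (List.filter (hasType? t) (List.map (a ∷_) αs)))
                             ≈ x zero ^ toℕ a * slice a
      sum-monomial-∷ a = begin
        sumₗ (List.map (monomial R x) (List.filter (hasType? t) (List.map (a ∷_) αs)))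
          ≡⟨ ≡.cong (sumₗ ∘ List.map (monomial R x)) (filter-map (hasType? t) (a ∷_) αs) ⟩
        sumₗ (List.map (monomial R x) (List.map (a ∷_) (List.filter (hasType? t ∘ (a ∷_)) αs)))
          ≡⟨ ≡.cong sumₗ (map-∘ (List.filter (hasType? t ∘ (a ∷_)) αs)) ⟨
        sumₗ (List.map (λ α → x zero ^ toℕ a * monomial R (x ∘ suc) α) (List.filter (hasType? t ∘ (a ∷_)) αs))
          ≈⟨ *-distribˡ-sumₗ (x zero ^ toℕ a) (monomial R (x ∘ suc)) (List.filter (hasType? t ∘ (a ∷_)) αs) ⟨
        x zero ^ toℕ a * slice a ∎

    monomialSym-∷ : monomialSym R t x ≈ monomialSym R t (x ∘ suc) + ∑[ j < k ] (x zero ^ suc (toℕ j) * slice (suc j))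
    monomialSym-∷ = begin
      sumₗ (List.map (monomial R x) (List.filter (hasType? t) (List.concatMap (λ a → List.map (a ∷_) αs) AF)))
        ≡⟨ ≡.cong (sumₗ ∘ List.map (monomial R x)) (filter-concatMap (hasType? t) (λ a → List.map (a ∷_) αs) AF) ⟩
      sumₗ (List.map (monomial R x) (List.concatMap (List.filter (hasType? t) ∘ λ a → List.map (a ∷_) αs) AF))
        ≡⟨ ≡.cong sumₗ (map-concatMap (monomial R x) (List.filter (hasType? t) ∘ λ a → List.map (a ∷_) αs) AF) ⟩
      sumₗ (List.concatMap (List.map (monomial R x) ∘ List.filter (hasType? t) ∘ λ a → List.map (a ∷_) αs) AF)
        ≈⟨ sumₗ-concatMap (List.map (monomial R x) ∘ List.filter (hasType? t) ∘ λ a → List.map (a ∷_) αs) AF ⟩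
      sumₗ (List.map (λ a → sumₗ (List.map (monomial R x) (List.filter (hasType? t) (List.map (a ∷_) αs)))) AF)
        ≡⟨ sumₗ-allFin (suc k) (λ a → sumₗ (List.map (monomial R x) (List.filter (hasType? t) (List.map (a ∷_) αs)))) ⟩
      ∑[ a < suc k ] sumₗ (List.map (monomial R x) (List.filter (hasType? t) (List.map (a ∷_) αs)))
        ≈⟨ sum-cong-≋ {suc k} sum-monomial-∷ ⟩
      1# * slice zero + ∑[ j < k ] (x zero ^ suc (toℕ j) * slice (suc j))
        ≈⟨ +-congʳ (*-identityˡ _) ⟩
      monomialSym R t (x ∘ suc) + ∑[ j < k ] (x zero ^ suc (toℕ j) * slice (suc j)) ∎
      where AF = List.allFin (suc k)

    factProd×slice : ∀ j y → factProd t × (y * slice (suc j)) ≈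
                     lookup t j × (y * (factProd (removePart j t) × monomialSym R (removePart j t) (x ∘ suc)))
    factProd×slice j y with lookup t j | factProd-removePart j t | filter-hasType-∷-positive t j αs | filter-hasType-∷-zero t j αs
    ... | zero  | _  | _        | sliceEmpty rewrite sliceEmpty ≡.refl =
      trans (×-congʳ (factProd t) (zeroʳ y)) (×-zeroʳ (factProd t))
    ... | suc m | F≡ | sliceEq  | _ rewrite F≡ (s≤s z≤n) | sliceEq (s≤s z≤n) =
      trans (sym (×-assocˡ _ (suc m) (factProd (removePart j t))))
            (×-congʳ (suc m) (sym (×-comm-* (factProd (removePart j t)) y (monomialSym R (removePart j t) (x ∘ suc)))))

  factProd×monomialSym : ∀ {k n} (t : Vec ℕ k) (x : Fin n → Carrier) →
                         factProd t × monomialSym R t x ≈ augmented t (Vec.toList (Vec.tabulate x))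
  factProd×monomialSym {n = zero} t x = base (hasType? t [])
    where
    F = factProd t
    base : Dec (HasType t []) → F × monomialSym R t x ≈ emptyIndicator t
    base (yes allZero) = begin
      F × monomialSym R t x  ≡⟨ ≡.cong (λ αs → F × sumₗ (List.map (monomial R x) αs)) (filter-accept (hasType? t) allZero) ⟩
      F × (1# + 0#)          ≡⟨ ≡.cong (_× (1# + 0#)) (factProd-allZero t allZero) ⟩
      1 × (1# + 0#)          ≈⟨ trans (×-homo-1 _) (+-identityʳ 1#) ⟩
      1#                     ≈⟨ emptyIndicator-allZero t allZero ⟨
      emptyIndicator t       ∎
    base (no notAllZero) = begin
      F × monomialSym R t x  ≡⟨ ≡.cong (λ αs → F × sumₗ (List.map (monomial R x) αs)) (filter-reject (hasType? t) notAllZero) ⟩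
      F × 0#                 ≈⟨ ×-zeroʳ F ⟩
      0#                     ≈⟨ emptyIndicator-notAllZero t notAllZero ⟨
      emptyIndicator t       ∎
  factProd×monomialSym {k} {suc n} t x = begin
    F × monomialSym R t x
      ≈⟨ ×-congʳ F (monomialSym-∷ t x) ⟩
    F × (monomialSym R t (x ∘ suc) + ∑[ j < k ] (x zero ^ suc (toℕ j) * slice t x (suc j)))
      ≈⟨ trans (×-distrib-+ _ _ F) (+-congˡ (×-distrib-sum F (λ j → x zero ^ suc (toℕ j) * slice t x (suc j)))) ⟩
    F × monomialSym R t (x ∘ suc) + ∑[ j < k ] (F × (x zero ^ suc (toℕ j) * slice t x (suc j)))
      ≈⟨ +-cong (factProd×monomialSym t (x ∘ suc)) (sum-cong-≋ {k} λ j → trans (factProd×slice t x j _)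
           (×-congʳ (lookup t j) (*-congˡ (factProd×monomialSym (removePart j t) (x ∘ suc))))) ⟩
    augmented t (Vec.toList (Vec.tabulate x)) ∎
    where F = factProd t

  signedFactorial : ℕ → Carrier
  signedFactorial l = (- 1#) ^ l * ((l !) × 1#)

  -1^suc*x≈-[-1^*x] : ∀ l x → (- 1#) ^ suc l * x ≈ - ((- 1#) ^ l * x)
  -1^suc*x≈-[-1^*x] l x = trans (*-assoc (- 1#) _ x) (-1*x≈-x _)

  suc×signedFactorial : ∀ l → suc l × signedFactorial l ≈ - signedFactorial (suc l)
  suc×signedFactorial l = begin
    suc l × ((- 1#) ^ l * ((l !) × 1#))    ≈⟨ ×-comm-* (suc l) _ _ ⟨
    (- 1#) ^ l * (suc l × ((l !) × 1#))    ≈⟨ *-congˡ (×-assocˡ 1# (suc l) (l !)) ⟩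
    (- 1#) ^ l * ((suc l !) × 1#)          ≈⟨ -‿involutive _ ⟨
    - (- ((- 1#) ^ l * ((suc l !) × 1#)))  ≈⟨ -‿cong (-1^suc*x≈-[-1^*x] l _) ⟨
    - signedFactorial (suc l)              ∎

  ×-signedFactorial : ∀ m l → m × (- signedFactorial l) ≈ (- 1#) ^ suc l * ((m ℕ.* l !) × 1#)
  ×-signedFactorial m l = begin
    m × (- signedFactorial l)              ≈⟨ ×-congʳ m (-1^suc*x≈-[-1^*x] l _) ⟨
    m × ((- 1#) ^ suc l * ((l !) × 1#))    ≈⟨ ×-comm-* m _ _ ⟨
    (- 1#) ^ suc l * (m × ((l !) × 1#))    ≈⟨ *-congˡ (×-assocˡ 1# m (l !)) ⟩
    (- 1#) ^ suc l * ((m ℕ.* l !) × 1#)    ∎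

  module _ (noZeroDivisors : ∀ x y → x * y ≈ 0# → x ≈ 0# ⊎ y ≈ 0#) where

    x≈u*x⇒x≈0 : ∀ {u x} → ¬ u ≈ 1# → x ≈ u * x → x ≈ 0#
    x≈u*x⇒x≈0 {u} {x} u≉1 x≈ux with noZeroDivisors (u - 1#) x (begin
      (u - 1#) * x    ≈⟨ [y-z]x≈yx-zx x u 1# ⟩
      u * x - 1# * x  ≈⟨ +-cong (sym x≈ux) (-‿cong (*-identityˡ x)) ⟩
      x - x           ≈⟨ -‿inverseʳ x ⟩
      0#              ∎)
    ... | inj₁ u-1≈0 = ⊥-elim (u≉1 (x∙y⁻¹≈ε⇒x≈y u 1# u-1≈0))
    ... | inj₂ x≈0   = x≈0

    ×-cancelˡ : ∀ n {x y} → ¬ n × 1# ≈ 0# → n × x ≈ n × y → x ≈ y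
    ×-cancelˡ n {x} {y} n≉0 nx≈ny with noZeroDivisors (n × 1#) (x - y) (begin
      n × 1# * (x - y)          ≈⟨ x[y-z]≈xy-xz _ x y ⟩
      n × 1# * x - n × 1# * y   ≈⟨ +-cong (scale x) (-‿cong (scale y)) ⟩
      n × x - n × y             ≈⟨ +-congʳ nx≈ny ⟩
      n × y - n × y             ≈⟨ -‿inverseʳ _ ⟩
      0#                        ∎)
      where
      scale : ∀ z → n × 1# * z ≈ n × z
      scale z = trans (×-assoc-* n 1# z) (×-congʳ n (*-identityˡ z))
    ... | inj₁ n≈0   = ⊥-elim (n≉0 n≈0)
    ... | inj₂ x-y≈0 = x∙y⁻¹≈ε⇒x≈y x y x-y≈0

  module _ (ω : Carrier) where

    powers : ℕ → ℕ → List Carrier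
    powers o zero    = []
    powers o (suc m) = ω ^ o ∷ powers (suc o) m

    length-powers : ∀ o m → List.length (powers o m) ≡ m
    length-powers o zero    = ≡.refl
    length-powers o (suc m) = ≡.cong suc (length-powers (suc o) m)

    powers-++ : ∀ o m n → powers o (m ℕ.+ n) ≡ powers o m ++ powers (o ℕ.+ m) n
    powers-++ o zero    n = ≡.cong (λ p → powers p n) (≡.sym (ℕₚ.+-identityʳ o))
    powers-++ o (suc m) n = ≡.cong (ω ^ o ∷_)
      (≡.trans (powers-++ (suc o) m n) (≡.cong (λ p → powers (suc o) m ++ powers p n) (≡.sym (ℕₚ.+-suc o m))))

    map-*-powers : ∀ a o m → Pointwise _≈_ (List.map (ω ^ a *_) (powers o m)) (powers (o ℕ.+ a) m)
    map-*-powers a o zero    = Pointwise.[]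
    map-*-powers a o (suc m) = trans (*-comm _ _) (sym (^-homo-* ω o a)) Pointwise.∷ map-*-powers a (suc o) m

    powers-periodic : ∀ {p} → ω ^ p ≈ 1# → ∀ o m → Pointwise _≈_ (powers (o ℕ.+ p) m) (powers o m)
    powers-periodic ω^p≈1 o zero    = Pointwise.[]
    powers-periodic ω^p≈1 o (suc m) =
      trans (^-homo-* ω o _) (trans (*-congˡ ω^p≈1) (*-identityʳ _)) Pointwise.∷ powers-periodic ω^p≈1 (suc o) m

    removeAt-powers : ∀ o m (i : Fin (List.length (powers o m))) →
      List.removeAt (powers o m) i ≡ powers o (toℕ i) ++ powers (o ℕ.+ suc (toℕ i)) (m ∸ suc (toℕ i))
    removeAt-powers o (suc m) zero    = ≡.cong (λ p → powers p m) (ℕₚ.+-comm 1 o)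
    removeAt-powers o (suc m) (suc i) = ≡.cong (ω ^ o ∷_) (≡.trans (removeAt-powers (suc o) m i)
      (≡.cong (λ p → powers (suc o) (toℕ i) ++ powers p (m ∸ suc (toℕ i))) (≡.sym (ℕₚ.+-suc o (suc (toℕ i))))))

    tabulate-powers : ∀ o m (f : Fin m → Carrier) → (∀ j → f j ≈ ω ^ (o ℕ.+ toℕ j)) →
                      Pointwise _≈_ (Vec.toList (Vec.tabulate f)) (powers o m)
    tabulate-powers o zero    f f≈ = Pointwise.[]
    tabulate-powers o (suc m) f f≈ = trans (f≈ zero) (^-congʳ ω (ℕₚ.+-identityʳ o)) Pointwise.∷
      tabulate-powers (suc o) m (f ∘ suc) (λ j → trans (f≈ (suc j)) (^-congʳ ω (ℕₚ.+-suc o (toℕ j))))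

    augmented-rotate : ∀ {k} (s : Vec ℕ k) j o m → ω ^ (o ℕ.+ m) ≈ 1# →
                       augmented s (powers 0 j ++ powers o m) ≈ augmented s (powers o (m ℕ.+ j))
    augmented-rotate s j o m ω^[o+m]≈1 = begin
      augmented s (powers 0 j ++ powers o m)              ≈⟨ augmented-perm (++-comm (powers 0 j) (powers o m)) s ⟩
      augmented s (powers o m ++ powers 0 j)              ≈⟨ augmented-cong s (Pointwise.++⁺ (Pointwise.refl refl {powers o m})
                                                               (powers-periodic {o ℕ.+ m} ω^[o+m]≈1 0 j)) ⟨
      augmented s (powers o m ++ powers (o ℕ.+ m) j)      ≡⟨ ≡.cong (augmented s) (powers-++ o m j) ⟨
      augmented s (powers o (m ℕ.+ j))                    ∎

  augmented-len≡0 : ∀ {k} (t : Vec ℕ k) → len t ≡ 0 → ∀ zs → augmented t zs ≈ 1#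
  augmented-len≡0 t len≡0 []       = emptyIndicator-allZero t (len≡0⇒lookup≡0 t len≡0)
  augmented-len≡0 t len≡0 (z ∷ zs) = trans (+-cong (augmented-len≡0 t len≡0 zs) vanish) (+-identityʳ 1#)
    where
    vanish : ∑[ i < _ ] (lookup t i × (z ^ suc (toℕ i) * augmented (removePart i t) zs)) ≈ 0#
    vanish = trans (∑-lookup×-const t _ {0#} λ i t[i]>0 → ⊥-elim (ℕₚ.<-irrefl (len≡0⇒lookup≡0 t len≡0 i) t[i]>0))
                   (×-zeroʳ (len t))

  module PrimitiveRoot (noZeroDivisors : ∀ x y → x * y ≈ 0# → x ≈ 0# ⊎ y ≈ 0#)
                       (n : ℕ) (ω : Carrier) (ω^[1+n]≈1 : ω ^ suc n ≈ 1#)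
                       (isPrimitive : ∀ j → 0 < j → j < suc n → ¬ ω ^ j ≈ 1#) where

    roots otherRoots : List Carrier
    roots      = powers ω 0 (suc n)
    otherRoots = powers ω 1 n

    [ω^a]^[1+n]≈1 : ∀ a → (ω ^ a) ^ suc n ≈ 1#
    [ω^a]^[1+n]≈1 a = begin
      (ω ^ a) ^ suc n      ≈⟨ ^-assocʳ ω a (suc n) ⟩
      ω ^ (a ℕ.* suc n)    ≡⟨ ≡.cong (ω ^_) (ℕₚ.*-comm a (suc n)) ⟩
      ω ^ (suc n ℕ.* a)    ≈⟨ ^-assocʳ ω (suc n) a ⟨
      (ω ^ suc n) ^ a      ≈⟨ ^-congˡ a ω^[1+n]≈1 ⟩
      1# ^ a               ≈⟨ 1^n≈1 a ⟩
      1#                   ∎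

    -- Multiplication by ω permutes the roots, and ω ^ size s ≠ 1.
    augmented-roots≈0 : ∀ {K} (s : Vec ℕ K) → 0 < size s → size s < suc n → augmented s roots ≈ 0#
    augmented-roots≈0 s size>0 size<1+n = x≈u*x⇒x≈0 noZeroDivisors (isPrimitive (size s) size>0 size<1+n) (begin
      augmented s roots                       ≈⟨ augmented-rotate ω s 1 1 n ω^[1+n]≈1 ⟩
      augmented s (powers ω 1 (n ℕ.+ 1))      ≡⟨ ≡.cong (augmented s ∘ powers ω 1) (ℕₚ.+-comm n 1) ⟩
      augmented s (powers ω 1 (suc n))        ≈⟨ augmented-cong s (map-*-powers ω 1 0 (suc n)) ⟨
      augmented s (List.map (ω ^ 1 *_) roots) ≈⟨ augmented-homogeneous (ω ^ 1) s roots ⟩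
      (ω ^ 1) ^ size s * augmented s roots    ≈⟨ *-congʳ (^-congˡ (size s) (*-identityʳ ω)) ⟩
      ω ^ size s * augmented s roots          ∎)

    -- Deleting ω^a from the roots leaves ω^a · otherRoots up to rotation, and (ω^a)^k = 1.
    augmented-removeAt-roots : ∀ {K} (t : Vec ℕ K) → size t ≡ suc n → ∀ i →
                               augmented t (List.removeAt roots i) ≈ augmented t otherRoots
    augmented-removeAt-roots t size≡ i = begin
      augmented t (List.removeAt roots i)                    ≡⟨ ≡.cong (augmented t) (removeAt-powers ω 0 (suc n) i) ⟩
      augmented t (powers ω 0 a ++ powers ω (suc a) (n ∸ a)) ≈⟨ augmented-rotate ω t a (suc a) (n ∸ a) ω^[1+a+[n∸a]]≈1 ⟩
      augmented t (powers ω (suc a) (n ∸ a ℕ.+ a))           ≡⟨ ≡.cong (augmented t ∘ powers ω (suc a)) (ℕₚ.m∸n+n≡m a≤n) ⟩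
      augmented t (powers ω (suc a) n)                       ≈⟨ augmented-cong t (map-*-powers ω a 1 n) ⟨
      augmented t (List.map (ω ^ a *_) otherRoots)           ≈⟨ augmented-homogeneous (ω ^ a) t otherRoots ⟩
      (ω ^ a) ^ size t * augmented t otherRoots              ≈⟨ *-congʳ (trans (^-congʳ (ω ^ a) size≡) ([ω^a]^[1+n]≈1 a)) ⟩
      1# * augmented t otherRoots                            ≈⟨ *-identityˡ _ ⟩
      augmented t otherRoots                                 ∎
      where
      a = toℕ i
      a≤n : a ≤ n
      a≤n = ℕₚ.≤-pred (≡.subst (a <_) (length-powers ω 0 (suc n)) (toℕ<n i))
      ω^[1+a+[n∸a]]≈1 : ω ^ (suc a ℕ.+ (n ∸ a)) ≈ 1#
      ω^[1+a+[n∸a]]≈1 = trans (^-congʳ ω (≡.cong suc (ℕₚ.m+[n∸m]≡n a≤n))) ω^[1+n]≈1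

    removalSum-roots : ∀ {K} (t : Vec ℕ K) → size t ≡ suc n → removalSum t roots ≈ suc n × augmented t otherRoots
    removalSum-roots t size≡ = begin
      removalSum t roots                                       ≈⟨ sum-cong-≋ (augmented-removeAt-roots t size≡) ⟩
      ∑[ i < List.length roots ] augmented t otherRoots        ≈⟨ sum-replicate (List.length roots) ⟩
      List.length roots × augmented t otherRoots               ≡⟨ ≡.cong (_× augmented t otherRoots) (length-powers ω 0 (suc n)) ⟩
      suc n × augmented t otherRoots                           ∎

    -- The first root is ω⁰ = 1, so expanding in it leaves the terms m̃_{s∖i}(otherRoots).
    augmented-roots : ∀ {K} (s : Vec ℕ K) l → len s ≡ suc l → size s ≤ suc n →
                      (∀ (s′ : Vec ℕ K) → len s′ ≡ l → size s′ < suc n → augmented s′ otherRoots ≈ signedFactorial l) →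
                      augmented s roots ≈ augmented s otherRoots - signedFactorial (suc l)
    augmented-roots {K} s l len≡1+l size≤1+n ih = +-congˡ (begin
      ∑[ i < K ] (lookup s i × (1# ^ suc (toℕ i) * augmented (removePart i s) otherRoots))
        ≈⟨ ∑-lookup×-const s _ {signedFactorial l} removed ⟩
      len s × signedFactorial l    ≡⟨ ≡.cong (_× signedFactorial l) len≡1+l ⟩
      suc l × signedFactorial l    ≈⟨ suc×signedFactorial l ⟩
      - signedFactorial (suc l)    ∎)
      where
      removed : ∀ i → 0 < lookup s i → 1# ^ suc (toℕ i) * augmented (removePart i s) otherRoots ≈ signedFactorial l
      removed i s[i]>0 = trans (*-congʳ (1^n≈1 (suc (toℕ i)))) (trans (*-identityˡ _) (ih (removePart i s)
        (ℕₚ.suc-injective (≡.trans (≡.sym (len-removePart i s s[i]>0)) len≡1+l))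
        (ℕₚ.<-≤-trans (size-removePart< i s s[i]>0) size≤1+n)))

    augmented-otherRoots : ∀ {K} l (s : Vec ℕ K) → len s ≡ l → size s < suc n →
                           augmented s otherRoots ≈ signedFactorial l
    augmented-otherRoots zero    s len≡0 _ =
      trans (augmented-len≡0 s len≡0 otherRoots) (sym (trans (*-identityˡ _) (+-identityʳ 1#)))
    augmented-otherRoots (suc l) s len≡1+l size<1+n = begin
      augmented s otherRoots           ≈⟨ +-inverseˡ-unique _ _ (trans (sym roots≈) (augmented-roots≈0 s size>0 size<1+n)) ⟩
      - (- signedFactorial (suc l))    ≈⟨ -‿involutive _ ⟩
      signedFactorial (suc l)          ∎
      where
      roots≈ = augmented-roots s l len≡1+l (ℕₚ.<⇒≤ size<1+n) (augmented-otherRoots l)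
      size>0 = ℕₚ.<-≤-trans (s≤s z≤n) (≡.subst (_≤ size s) len≡1+l (len≤size s))

    len×augmented-otherRoots : ∀ {K} (t : Vec ℕ K) → size t ≡ suc n →
                               len t × augmented t otherRoots ≈ (suc n ∸ len t) × (- signedFactorial (len t))
    len×augmented-otherRoots t size≡ = +-cancelʳ (l × W) _ _ (+-cancelˡ (suc n × A) _ _ (begin
      suc n × A + (l × A + l × W)            ≈⟨ +-cong (removalSum-roots t size≡) (×-distrib-+ A W l) ⟨
      removalSum t roots + l × (A + W)       ≈⟨ +-congˡ (×-congʳ l roots≈) ⟨
      removalSum t roots + l × N             ≈⟨ removalSum+len×augmented t roots ⟩
      List.length roots × N                  ≡⟨ ≡.cong (_× N) (length-powers ω 0 (suc n)) ⟩
      suc n × N                              ≈⟨ ×-congʳ (suc n) roots≈ ⟩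
      suc n × (A + W)                        ≈⟨ ×-distrib-+ A W (suc n) ⟩
      suc n × A + suc n × W                  ≈⟨ +-congˡ (trans (×-congˡ (≡.sym (ℕₚ.m∸n+n≡m l≤1+n))) (×-homo-+ W (suc n ∸ l) l)) ⟩
      suc n × A + ((suc n ∸ l) × W + l × W)  ∎))
      where
      l = len t
      A = augmented t otherRoots
      N = augmented t roots
      W = - signedFactorial l
      l≤1+n : l ≤ suc n
      l≤1+n = ≡.subst (l ≤_) size≡ (len≤size t)
      l≡1+pred : l ≡ suc (ℕ.pred l)
      l≡1+pred = ≡.sym (ℕₚ.suc-pred l {{ℕ.>-nonZero (0<size⇒0<len t (≡.subst (0 <_) (≡.sym size≡) (s≤s z≤n)))}})
      roots≈ : N ≈ A + W
      roots≈ = trans (augmented-roots t (ℕ.pred l) l≡1+pred (ℕₚ.≤-reflexive size≡) (augmented-otherRoots (ℕ.pred l)))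
                     (+-congˡ (-‿cong (reflexive (≡.cong signedFactorial (≡.sym l≡1+pred)))))

    len×monomialSym : (∀ m → m × 1# ≈ 0# → m ≡ 0) → ∀ {K} (t : Vec ℕ K) → size t ≡ suc n →
                      len t × monomialSym R t (λ (j : Fin n) → ω ^ suc (toℕ j))
                        ≈ (- 1#) ^ suc (len t) * (((suc n ∸ len t) ℕ.* multinomial t) × 1#)
    len×monomialSym charZero t size≡ = ×-cancelˡ noZeroDivisors F F×1≉0 (begin
      F × (l × m)                                      ≈⟨ ×-comm F l m ⟩
      l × (F × m)                                      ≈⟨ ×-congʳ l (factProd×monomialSym t x) ⟩
      l × augmented t (Vec.toList (Vec.tabulate x))    ≈⟨ ×-congʳ l (augmented-cong t (tabulate-powers ω 1 n x λ _ → refl)) ⟩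
      l × augmented t otherRoots                       ≈⟨ len×augmented-otherRoots t size≡ ⟩
      (suc n ∸ l) × (- signedFactorial l)              ≈⟨ ×-signedFactorial (suc n ∸ l) l ⟩
      (- 1#) ^ suc l * (((suc n ∸ l) ℕ.* l !) × 1#)   ≡⟨ ≡.cong (λ c → (- 1#) ^ suc l * (c × 1#)) count ⟩
      (- 1#) ^ suc l * ((F ℕ.* Q) × 1#)                ≈⟨ *-congˡ (×-assocˡ 1# F Q) ⟨
      (- 1#) ^ suc l * (F × (Q × 1#))                  ≈⟨ ×-comm-* F _ _ ⟩
      F × ((- 1#) ^ suc l * (Q × 1#))                  ∎)
      where
      F = factProd t
      l = len t
      Q = (suc n ∸ l) ℕ.* multinomial t
      x : Fin n → Carrier
      x j = ω ^ suc (toℕ j)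
      m = monomialSym R t x
      F×1≉0 : ¬ F × 1# ≈ 0#
      F×1≉0 F×1≈0 = ℕ.≢-nonZero⁻¹ F {{factProd≢0 t}} (charZero F F×1≈0)
      count : (suc n ∸ l) ℕ.* l ! ≡ F ℕ.* Q
      count = ≡.trans (≡.cong ((suc n ∸ l) ℕ.*_) (≡.sym (factProd*multinomial t))) (ℕ*.x∙yz≈y∙xz (suc n ∸ l) F _)

corollary3p6 : ∀ {c ℓ : Level} (R : CommutativeRing c ℓ) →
    let open CommutativeRing R in
    (∀ x y → x * y ≈ 0# → x ≈ 0# ⊎ y ≈ 0#) →
    (∀ (m : ℕ) → scal R m 1# ≈ 0# → m ≡ 0) →
    (k : ℕ) → 1 < k →
    (ω : Carrier) → pow R ω k ≈ 1# →
    (∀ (j : ℕ) → 0 < j → j < k → ¬ (pow R ω j ≈ 1#)) →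
    (t : Vec ℕ k) → size t ≡ k → len t < k →
    scal R (len t)
        (monomialSym R t {k ∸ 1} (λ (j : Fin (k ∸ 1)) → pow R ω (suc (toℕ j))))
      ≈ pow R (- 1#) (suc (len t))
          * scal R ((k ∸ len t) ℕ.* multinomial t) 1#
corollary3p6 R noZeroDivisors charZero (suc n) _ ω ω^k≈1 isPrimitive t size≡k _ =
  PrimitiveRoot.len×monomialSym R noZeroDivisors n ω ω^k≈1 isPrimitive charZero t size≡k
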